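{- Let $a,b$ be coprime positive integers and $0\le k<b$. A chip configuration $D\ge 0$ is $k$-stable if and only if the last $k+1$ north steps of $\mathrm{lpath}(D)$ start at points $(x,y)$ with $x\le (a/b)y$ (that is, on or above the line $bx=ay$).
   Context: Write $[b]=\{1,\dots,b\}$. A chip configuration is $D:[b]\to\mathbb{Z}$; $D\ge0$ means all values nonnegative. For $S\subseteq[b]$ with $|S|=s$, $\phi_S$ subtracts $1+\lfloor (b-s)a/b\rfloor$ from $D(i)$ for $i\in S$ and adds $\lfloor sa/b\rfloor$ to $D(j)$ for $j\in[b]\setminus S$; for $D\ge 0$ it is legal if $\phi_S(D)\ge 0$. A $k$-firing move is $\phi_S$ with $0<|S|\le k+1$; $D\ge0$ is $k$-stable if no $k$-firing move is legal on $D$. For $D\ge0$: $i$ is poorer than $j$ if $D(i)<D(j)$ or ($D(i)=D(j)$ and $i<j$); let $w_1,\dots,w_b$ be the vertices from poorest to richest and $x_t=D(w_t)$. $\mathrm{lpath}(D)$ is the lattice path from $(0,0)$ having, for each $t$, a north step from $(x_t,t-1)$ to $(x_t,t)$ labeled $w_t$, consecutive north steps joined by east steps, and ending with east steps from $(x_b,b)$ to $(a,b)$ if $x_b\le a$ (ending at $(x_b,b)$ otherwise). -}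

module Defs where

open import Data.Nat as ℕ using (ℕ; zero; suc; _+_; _*_; _∸_; NonZero)
open import Data.Nat.DivMod using (_/_)
open import Data.Integer as ℤ using (ℤ; +_; 0ℤ)
open import Data.Fin as Fin using (Fin)
open import Data.Fin.Subset using (Subset; ∣_∣)
open import Data.Vec using (lookup)
open import Data.Bool using (if_then_else_)
open import Data.List using (List; []; _∷_; _++_; replicate; length; drop)
open import Data.List.Relation.Unary.All using (All)
open import Data.Product using (_×_; _,_; proj₁; proj₂)
open import Data.Sum using (_⊎_; inj₁; inj₂)
open import Relation.Binary.PropositionalEquality using (_≡_)
open import Relation.Nullary using (¬_; Dec; yes; no)

-- Vertices [b] = {1,…,b} are represented by Fin b (vertex i+1 ↦ index i;
-- this preserves the order used for tie-breaking).
Config : ℕ → Set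
Config b = Fin b → ℤ

NonNeg : ∀ {b} → Config b → Set
NonNeg {b} D = ∀ (i : Fin b) → 0ℤ ℤ.≤ D i

φ : (a b : ℕ) → .{{_ : NonZero b}} → Subset b → Config b → Config b
φ a b S D i =
  if lookup S i
  then D i ℤ.- + (1 + ((b ∸ ∣ S ∣) * a) / b)
  else D i ℤ.+ + ((∣ S ∣ * a) / b)

Legal : (a b : ℕ) → .{{_ : NonZero b}} → Subset b → Config b → Set
Legal a b S D = NonNeg (φ a b S D)

KStable : (a b : ℕ) → .{{_ : NonZero b}} → ℕ → Config b → Set
KStable a b k D =
  ∀ (S : Subset b) → 0 ℕ.< ∣ S ∣ → ∣ S ∣ ℕ.≤ suc k → ¬ Legal a b S D

Poorer : ∀ {b} → Config b → Fin b → Fin b → Set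
Poorer D i j = D i ℤ.< D j ⊎ (D i ≡ D j × i Fin.< j)

poorer? : ∀ {b} (D : Config b) (i j : Fin b) → Dec (Poorer D i j)
poorer? D i j with D i ℤ.<? D j
... | yes p = yes (inj₁ p)
... | no ¬p with D i ℤ.≟ D j | i Fin.<? j
...   | yes e | yes l = yes (inj₂ (e , l))
...   | yes e | no ¬l = no λ { (inj₁ p) → ¬p p ; (inj₂ (_ , l)) → ¬l l }
...   | no ¬e | _     = no λ { (inj₁ p) → ¬p p ; (inj₂ (e , _)) → ¬e e }

insert : ∀ {b} → Config b → Fin b → List (Fin b) → List (Fin b)
insert D i [] = i ∷ []
insert D i (j ∷ js) with poorer? D i j
... | yes _ = i ∷ j ∷ js
... | no  _ = j ∷ insert D i js

sortVerts : ∀ {b} → Config b → List (Fin b) → List (Fin b)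
sortVerts D [] = []
sortVerts D (i ∷ is) = insert D i (sortVerts D is)

ordering : ∀ {b} → Config b → List (Fin b)
ordering D = sortVerts D (Data.List.allFin _)
  where import Data.List

data Step (b : ℕ) : Set where
  north : Fin b → Step b
  east  : Step b

-- Build the path; `cur` is the current x-coordinate.  Values D(w_t) are
-- read as natural numbers (D ≥ 0).
pathFrom : ∀ {b} → ℕ → Config b → ℕ → List (Fin b) → List (Step b)
pathFrom a D cur [] with cur ℕ.≤? a
... | yes _ = replicate (a ∸ cur) east
... | no  _ = []
pathFrom a D cur (w ∷ ws) =
  replicate (ℤ.∣ D w ∣ ∸ cur) east ++ (north w ∷ pathFrom a D ℤ.∣ D w ∣ ws)

lpath : ∀ {b} → ℕ → Config b → List (Step b)
lpath a D = pathFrom a D 0 (ordering D)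

northStartsFrom : ∀ {b} → ℕ × ℕ → List (Step b) → List (ℕ × ℕ)
northStartsFrom p [] = []
northStartsFrom (x , y) (east ∷ st) = northStartsFrom (suc x , y) st
northStartsFrom (x , y) (north _ ∷ st) = (x , y) ∷ northStartsFrom (x , suc y) st

northStarts : ∀ {b} → List (Step b) → List (ℕ × ℕ)
northStarts = northStartsFrom (0 , 0)

lastN : ∀ {A : Set} → ℕ → List A → List A
lastN n xs = drop (length xs ∸ n) xs

OnOrAbove : ℕ → ℕ → ℕ × ℕ → Set
OnOrAbove a b (x , y) = b * x ℕ.≤ a * y

LPathCond : (a b k : ℕ) → Config b → Set
LPathCond a b k D = All (OnOrAbove a b) (lastN (suc k) (northStarts (lpath a D)))

{-# OPTIONS --safe #-}
-- Firing S, with s = |S|, only takes chips from S, so φ_S is legal exactly when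
-- a(b − s) < b·D(i) for every i ∈ S: each vertex of S, put at height b − s, lies strictly
-- below the line bx = ay.  The north steps of lpath(D) start at (D(w_t), t − 1), with D(w_t)
-- increasing in t.  If the step at height b − s starts strictly below the line, then so do
-- the richer vertices above it, and w_{b−s+1}, …, w_b form a legal set of size at most s.
-- If instead it starts on or above the line, a legal S of size s must avoid
-- w_1, …, w_{b−s+1}, leaving only s − 1 vertices for its s elements.
module Submission where

open import Defs
open import Data.Nat using (ℕ; zero; suc; _+_; _*_; _∸_; _≤_; _<_; NonZero; z≤n; s≤s)
open import Data.Nat.Properties
open import Data.Nat.DivMod using (_/_; m<n*o⇒m/o<n; m*n/n≡m; /-monoˡ-≤)
open import Data.Nat.Coprimality using (Coprime)
open import Data.Integer as ℤ using (+_; 0ℤ)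
import Data.Integer.Properties as ℤ
open import Data.Fin using (Fin)
open import Data.Fin.Subset as Subset using (Subset; ∣_∣; ⊥; ⁅_⁆; _∪_; ∁; inside; outside)
import Data.Fin.Subset.Properties as Subset
open import Data.Vec using (lookup; []; _∷_)
import Data.Vec.Properties as Vec
open import Data.List using (List; []; _∷_; _++_; replicate; length; drop; allFin)
open import Data.List.Properties using (length-++; length-tabulate)
open import Data.List.Membership.Propositional using (_∈_)
open import Data.List.Membership.Propositional.Properties using (∈-allFin; ∈-++⁻)
open import Data.List.Relation.Unary.Any using (here; there)
open import Data.List.Relation.Unary.All as All using (All; []; _∷_)
open import Data.List.Relation.Unary.All.Properties using (++⁻ʳ)
open import Data.List.Relation.Unary.AllPairs as AllPairs using (AllPairs; []; _∷_)
open import Data.List.Relation.Binary.Permutation.Propositional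
  using (_↭_; ↭-refl; ↭-prep; ↭-swap; ↭-trans; ↭-sym)
open import Data.List.Relation.Binary.Permutation.Propositional.Properties
  using (All-resp-↭; ∈-resp-↭; ↭-length)
open import Data.Product using (_×_; _,_; ∃; ∃₂)
open import Data.Sum using (inj₁; inj₂)
open import Data.Empty using (⊥-elim)
open import Function using (_∘_)
open import Function.Bundles using (_⇔_; mk⇔; Equivalence)
open import Level using (0ℓ)
open import Relation.Binary.Core using (Rel)
open import Relation.Binary.PropositionalEquality
open import Relation.Nullary using (¬_; yes; no)

open Equivalence using (to; from)

value : ∀ {b} → Config b → Fin b → ℕ
value D i = ℤ.∣ D i ∣

StrictlyBelow : ℕ → ℕ → ℕ × ℕ → Set
StrictlyBelow a b (x , y) = a * y < b * x

module _ {b : ℕ} (D : Config b) where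

  insert-↭ : ∀ i js → insert D i js ↭ i ∷ js
  insert-↭ i [] = ↭-refl
  insert-↭ i (j ∷ js) with poorer? D i j
  ... | yes _ = ↭-refl
  ... | no  _ = ↭-trans (↭-prep j (insert-↭ i js)) (↭-swap j i ↭-refl)

  sortVerts-↭ : ∀ is → sortVerts D is ↭ is
  sortVerts-↭ [] = ↭-refl
  sortVerts-↭ (i ∷ is) = ↭-trans (insert-↭ i (sortVerts D is)) (↭-prep i (sortVerts-↭ is))

  ordering-complete : ∀ i → i ∈ ordering D
  ordering-complete i = ∈-resp-↭ (↭-sym (sortVerts-↭ (allFin b))) (∈-allFin i)

  length-ordering : length (ordering D) ≡ b
  length-ordering = trans (↭-length (sortVerts-↭ (allFin b))) (length-tabulate (λ i → i))

  _≼_ : Rel (Fin b) 0ℓ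
  i ≼ j = D i ℤ.≤ D j

  poorer⇒≼ : ∀ {i j} → Poorer D i j → i ≼ j
  poorer⇒≼ (inj₁ Di<Dj)       = ℤ.<⇒≤ Di<Dj
  poorer⇒≼ (inj₂ (Di≡Dj , _)) = ℤ.≤-reflexive Di≡Dj

  insert-sorted : ∀ i js → AllPairs _≼_ js → AllPairs _≼_ (insert D i js)
  insert-sorted i [] [] = [] ∷ []
  insert-sorted i (j ∷ js) (j≼js ∷ js↑) with poorer? D i j
  ... | yes i≺j = (poorer⇒≼ i≺j ∷ All.map (ℤ.≤-trans (poorer⇒≼ i≺j)) j≼js) ∷ j≼js ∷ js↑
  ... | no i⊀j = All-resp-↭ (↭-sym (insert-↭ i js)) (ℤ.≮⇒≥ (i⊀j ∘ inj₁) ∷ j≼js)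
               ∷ insert-sorted i js js↑

  sortVerts-sorted : ∀ is → AllPairs _≼_ (sortVerts D is)
  sortVerts-sorted [] = []
  sortVerts-sorted (i ∷ is) = insert-sorted i (sortVerts D is) (sortVerts-sorted is)

  Ascending : List (Fin b) → Set
  Ascending = AllPairs (λ i j → value D i ≤ value D j)

  ordering-ascending : NonNeg D → Ascending (ordering D)
  ordering-ascending D≥0 = AllPairs.map (λ {i} {j} Di≤Dj → ℤ.drop‿+≤+
    (subst₂ ℤ._≤_ (sym (ℤ.0≤i⇒+∣i∣≡i (D≥0 i))) (sym (ℤ.0≤i⇒+∣i∣≡i (D≥0 j))) Di≤Dj))
    (sortVerts-sorted (allFin b))

module _ {α ℓ} {A : Set α} {R : Rel A ℓ} where

  AllPairs-pivotˡ : ∀ xs {y ys} → AllPairs R (xs ++ y ∷ ys) → All (λ x → R x y) xs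
  AllPairs-pivotˡ []       _           = []
  AllPairs-pivotˡ (x ∷ xs) (x≤ ∷ rest) = All.head (++⁻ʳ xs x≤) ∷ AllPairs-pivotˡ xs rest

  AllPairs-pivotʳ : ∀ xs {y ys} → AllPairs R (xs ++ y ∷ ys) → All (R y) ys
  AllPairs-pivotʳ []       (y≤ ∷ _)   = y≤
  AllPairs-pivotʳ (x ∷ xs) (_ ∷ rest) = AllPairs-pivotʳ xs rest

split-at : ∀ {α} {A : Set α} n (xs : List A) → n < length xs →
           ∃₂ λ ys z → ∃ λ zs → xs ≡ ys ++ z ∷ zs × length ys ≡ n
split-at zero    (x ∷ xs) _         = [] , x , xs , refl , refl
split-at (suc n) (x ∷ xs) (s≤s n<) with split-at n xs n<
... | ys , z , zs , refl , refl = x ∷ ys , z , zs , refl , refl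

module _ {b : ℕ} where

  northStartsFrom-east : ∀ n x y (st : List (Step b)) →
    northStartsFrom (x , y) (replicate n east ++ st) ≡ northStartsFrom (x + n , y) st
  northStartsFrom-east zero    x y st rewrite +-identityʳ x = refl
  northStartsFrom-east (suc n) x y st rewrite +-suc x n = northStartsFrom-east n (suc x) y st

  northStartsFrom-east-only : ∀ n x y → northStartsFrom {b} (x , y) (replicate n east) ≡ []
  northStartsFrom-east-only zero    x y = refl
  northStartsFrom-east-only (suc n) x y = northStartsFrom-east-only n (suc x) y

module _ {b : ℕ} (D : Config b) where

  northStartsAt : ℕ → List (Fin b) → List (ℕ × ℕ)
  northStartsAt y []       = []
  northStartsAt y (w ∷ ws) = (value D w , y) ∷ northStartsAt (suc y) ws

  length-northStartsAt : ∀ y ws → length (northStartsAt y ws) ≡ length ws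
  length-northStartsAt y []       = refl
  length-northStartsAt y (w ∷ ws) = cong suc (length-northStartsAt (suc y) ws)

  northStarts-pathFrom : ∀ a cur y ws → All (λ w → cur ≤ value D w) ws → Ascending D ws →
    northStartsFrom (cur , y) (pathFrom a D cur ws) ≡ northStartsAt y ws
  northStarts-pathFrom a cur y [] _ _ with cur ≤? a
  ... | yes _ = northStartsFrom-east-only (a ∸ cur) cur y
  ... | no  _ = refl
  northStarts-pathFrom a cur y (w ∷ ws) (cur≤w ∷ _) (w≤ws ∷ ws↑) = begin
    northStartsFrom (cur , y) (replicate (value D w ∸ cur) east ++ rest)
      ≡⟨ northStartsFrom-east (value D w ∸ cur) cur y rest ⟩
    northStartsFrom (cur + (value D w ∸ cur) , y) rest
      ≡⟨ cong (λ x → northStartsFrom (x , y) rest) (m+[n∸m]≡n cur≤w) ⟩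
    (value D w , y) ∷ northStartsFrom (value D w , suc y) (pathFrom a D (value D w) ws)
      ≡⟨ cong (_ ∷_) (northStarts-pathFrom a (value D w) (suc y) ws w≤ws ws↑) ⟩
    (value D w , y) ∷ northStartsAt (suc y) ws ∎
    where
    open ≡-Reasoning
    rest = north w ∷ pathFrom a D (value D w) ws

  lastN-northStarts-lpath : ∀ a k → NonNeg D →
    lastN (suc k) (northStarts (lpath a D)) ≡ drop (b ∸ suc k) (northStartsAt 0 (ordering D))
  lastN-northStarts-lpath a k D≥0
    rewrite northStarts-pathFrom a 0 0 (ordering D) (All.tabulate (λ _ → z≤n)) (ordering-ascending D D≥0)
          | length-northStartsAt 0 (ordering D)
          | length-ordering D = refl

  drop-northStartsAt⁻ : ∀ {P : ℕ × ℕ → Set} m y ws → All P (drop m (northStartsAt y ws)) →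
    ∀ A w B → ws ≡ A ++ w ∷ B → m ≤ length A → P (value D w , y + length A)
  drop-northStartsAt⁻ {P} zero y (w ∷ _) (p ∷ _) [] _ _ refl _ =
    subst (λ h → P (value D w , h)) (sym (+-identityʳ y)) p
  drop-northStartsAt⁻ {P} zero y (x ∷ ws) (_ ∷ ps) (_ ∷ A) w B refl _ =
    subst (λ h → P (value D w , h)) (sym (+-suc y (length A)))
      (drop-northStartsAt⁻ zero (suc y) ws ps A w B refl z≤n)
  drop-northStartsAt⁻ {P} (suc m) y (x ∷ ws) ps (_ ∷ A) w B refl (s≤s m≤A) =
    subst (λ h → P (value D w , h)) (sym (+-suc y (length A)))
      (drop-northStartsAt⁻ m (suc y) ws ps A w B refl m≤A)

  drop-northStartsAt⁺ : ∀ {P : ℕ × ℕ → Set} m y ws →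
    (∀ A w B → ws ≡ A ++ w ∷ B → m ≤ length A → P (value D w , y + length A)) →
    All P (drop m (northStartsAt y ws))
  drop-northStartsAt⁺ zero    y [] _ = []
  drop-northStartsAt⁺ (suc m) y [] _ = []
  drop-northStartsAt⁺ {P} zero y (x ∷ ws) h =
    subst (λ h → P (value D x , h)) (+-identityʳ y) (h [] x ws refl z≤n)
    ∷ drop-northStartsAt⁺ zero (suc y) ws λ A w B ws≡ _ →
        subst (λ h → P (value D w , h)) (+-suc y (length A)) (h (x ∷ A) w B (cong (x ∷_) ws≡) z≤n)
  drop-northStartsAt⁺ {P} (suc m) y (x ∷ ws) h =
    drop-northStartsAt⁺ m (suc y) ws λ A w B ws≡ m≤A →
      subst (λ h → P (value D w , h)) (+-suc y (length A)) (h (x ∷ A) w B (cong (x ∷_) ws≡) (s≤s m≤A))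

module _ {n : ℕ} where

  fromList : List (Fin n) → Subset n
  fromList []       = ⊥
  fromList (x ∷ xs) = ⁅ x ⁆ ∪ fromList xs

  ∈-fromList⁺ : ∀ {x xs} → x ∈ xs → x Subset.∈ fromList xs
  ∈-fromList⁺ {xs = y ∷ xs} (here refl) = Subset.x∈p∪q⁺ {p = ⁅ y ⁆} {q = fromList xs} (inj₁ (Subset.x∈⁅x⁆ y))
  ∈-fromList⁺ {xs = y ∷ xs} (there x∈) = Subset.x∈p∪q⁺ {p = ⁅ y ⁆} {q = fromList xs} (inj₂ (∈-fromList⁺ x∈))

  ∈-fromList⁻ : ∀ {x} xs → x Subset.∈ fromList xs → x ∈ xs
  ∈-fromList⁻ []       x∈ = ⊥-elim (Subset.∉⊥ x∈)
  ∈-fromList⁻ (y ∷ xs) x∈ with Subset.x∈p∪q⁻ ⁅ y ⁆ (fromList xs) x∈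
  ... | inj₁ x∈⁅y⁆ = here (Subset.x∈⁅y⁆⇒x≡y y x∈⁅y⁆)
  ... | inj₂ x∈xs  = there (∈-fromList⁻ xs x∈xs)

∣p∪q∣≤∣p∣+∣q∣ : ∀ {n} (p q : Subset n) → ∣ p ∪ q ∣ ≤ ∣ p ∣ + ∣ q ∣
∣p∪q∣≤∣p∣+∣q∣ []            []            = z≤n
∣p∪q∣≤∣p∣+∣q∣ (inside ∷ p)  (inside ∷ q)  = s≤s (≤-trans (∣p∪q∣≤∣p∣+∣q∣ p q) (+-monoʳ-≤ ∣ p ∣ (n≤1+n ∣ q ∣)))
∣p∪q∣≤∣p∣+∣q∣ (inside ∷ p)  (outside ∷ q) = s≤s (∣p∪q∣≤∣p∣+∣q∣ p q)
∣p∪q∣≤∣p∣+∣q∣ (outside ∷ p) (inside ∷ q)  = subst (suc ∣ p ∪ q ∣ ≤_) (sym (+-suc ∣ p ∣ ∣ q ∣)) (s≤s (∣p∪q∣≤∣p∣+∣q∣ p q))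
∣p∪q∣≤∣p∣+∣q∣ (outside ∷ p) (outside ∷ q) = ∣p∪q∣≤∣p∣+∣q∣ p q

∣fromList∣≤length : ∀ {n} (xs : List (Fin n)) → ∣ fromList xs ∣ ≤ length xs
∣fromList∣≤length {n} []       = ≤-reflexive (Subset.∣⊥∣≡0 n)
∣fromList∣≤length     (x ∷ xs) = ≤-trans (∣p∪q∣≤∣p∣+∣q∣ ⁅ x ⁆ (fromList xs))
  (+-mono-≤ (≤-reflexive (Subset.∣⁅x⁆∣≡1 x)) (∣fromList∣≤length xs))

∣p∣≤length : ∀ {n} (p : Subset n) xs → (∀ {x} → x Subset.∈ p → x ∈ xs) → ∣ p ∣ ≤ length xs
∣p∣≤length p xs p⊆xs = ≤-trans (Subset.p⊆q⇒∣p∣≤∣q∣ (∈-fromList⁺ ∘ p⊆xs)) (∣fromList∣≤length xs)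

m/o<n⇒m<n*o : ∀ {m n o} .{{_ : NonZero o}} → m / o < n → m < n * o
m/o<n⇒m<n*o {m} {n} {o} m/o<n = ≰⇒> λ n*o≤m → <⇒≱ m/o<n (begin
  n         ≡⟨ m*n/n≡m n o ⟨
  n * o / o ≤⟨ /-monoˡ-≤ o n*o≤m ⟩
  m / o     ∎)
  where open ≤-Reasoning

0≤d-[1+q/b]⇔q<∣d∣*b : ∀ q b .{{_ : NonZero b}} {d} → 0ℤ ℤ.≤ d →
                      (0ℤ ℤ.≤ d ℤ.- + (1 + q / b) ⇔ q < ℤ.∣ d ∣ * b)
0≤d-[1+q/b]⇔q<∣d∣*b q b {+ x} _ = mk⇔
  (λ 0≤x-[1+q/b] → m/o<n⇒m<n*o {n = x} (ℤ.drop‿+≤+ (ℤ.0≤i-j⇒j≤i 0≤x-[1+q/b])))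
  (λ q<x*b → ℤ.i≤j⇒0≤j-i (ℤ.+≤+ (m<n*o⇒m/o<n {n = x} q<x*b)))
0≤d-[1+q/b]⇔q<∣d∣*b q b {ℤ.-[1+ _ ]} ()

module _ (a b : ℕ) .{{_ : NonZero b}} where

  legal⇔ : ∀ {D : Config b} (S : Subset b) → NonNeg D →
    Legal a b S D ⇔ (∀ {i} → i Subset.∈ S → StrictlyBelow a b (value D i , b ∸ ∣ S ∣))
  legal⇔ {D} S D≥0 = mk⇔
    (λ legal {i} i∈S → threshold⇔ i .to (subst (0ℤ ℤ.≤_) (φ-inside i∈S) (legal i)))
    (λ below i → fires i below)
    where
    q = (b ∸ ∣ S ∣) * a

    threshold⇔ : ∀ i → (0ℤ ℤ.≤ D i ℤ.- + (1 + q / b)) ⇔ StrictlyBelow a b (value D i , b ∸ ∣ S ∣)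
    threshold⇔ i = subst (λ r → (0ℤ ℤ.≤ D i ℤ.- + (1 + q / b)) ⇔ r) (cong₂ _<_ (*-comm (b ∸ ∣ S ∣) a) (*-comm (value D i) b))
                     (0≤d-[1+q/b]⇔q<∣d∣*b q b (D≥0 i))

    φ-inside : ∀ {i} → i Subset.∈ S → φ a b S D i ≡ D i ℤ.- + (1 + q / b)
    φ-inside i∈S rewrite Vec.[]=⇒lookup i∈S = refl

    fires : ∀ i → (∀ {i} → i Subset.∈ S → StrictlyBelow a b (value D i , b ∸ ∣ S ∣)) →
            0ℤ ℤ.≤ φ a b S D i
    fires i below with lookup S i in Si≡
    ... | inside  = threshold⇔ i .from (below (Vec.lookup⇒[]= i S Si≡))
    ... | outside = ℤ.≤-trans (D≥0 i) (ℤ.i≤i+j (D i) _)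

module _ (a b : ℕ) .{{_ : NonZero b}} {D : Config b} (D≥0 : NonNeg D) where

  length-split : ∀ {A w B} → ordering D ≡ A ++ w ∷ B → length A + suc (length B) ≡ b
  length-split {A} L≡ = trans (sym (length-++ A)) (trans (cong length (sym L≡)) (length-ordering D))

  below⇒legal : ∀ {A w B} → ordering D ≡ A ++ w ∷ B → StrictlyBelow a b (value D w , length A) →
                Legal a b (fromList (w ∷ B)) D
  below⇒legal {A} {w} {B} L≡ below = legal⇔ a b S D≥0 .from λ {i} i∈S → begin-strict
    a * (b ∸ ∣ S ∣)  ≤⟨ *-monoʳ-≤ a b∸∣S∣≤∣A∣ ⟩
    a * length A     <⟨ below ⟩
    b * value D w    ≤⟨ *-monoʳ-≤ b (w≼ (∈-fromList⁻ (w ∷ B) i∈S)) ⟩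
    b * value D i    ∎
    where
    open ≤-Reasoning
    S = fromList (w ∷ B)

    w≼ : ∀ {i} → i ∈ w ∷ B → value D w ≤ value D i
    w≼ (here refl) = ≤-refl
    w≼ (there i∈B) = All.lookup (AllPairs-pivotʳ A (subst (Ascending D) L≡ (ordering-ascending D D≥0))) i∈B

    ∁S⊆A : ∀ {i} → i Subset.∈ ∁ S → i ∈ A
    ∁S⊆A {i} i∉S with ∈-++⁻ A (subst (i ∈_) L≡ (ordering-complete D i))
    ... | inj₁ i∈A   = i∈A
    ... | inj₂ i∈w∷B = ⊥-elim (Subset.x∈∁p⇒x∉p i∉S (∈-fromList⁺ i∈w∷B))

    b∸∣S∣≤∣A∣ : b ∸ ∣ S ∣ ≤ length A
    b∸∣S∣≤∣A∣ = subst (_≤ length A) (Subset.∣∁p∣≡n∸∣p∣ S) (∣p∣≤length (∁ S) A ∁S⊆A)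

  legal⇒below : ∀ {S A w B} → Legal a b S D → 0 < ∣ S ∣ →
                ordering D ≡ A ++ w ∷ B → length A ≡ b ∸ ∣ S ∣ → ¬ OnOrAbove a b (value D w , length A)
  legal⇒below {S} {A} {w} {B} legal 0<∣S∣ L≡ ∣A∣≡ above = <⇒≱ ∣B∣<∣S∣ (∣p∣≤length S B S⊆B)
    where
    w≺ : ∀ {i} → i Subset.∈ S → value D w < value D i
    w≺ {i} i∈S = *-cancelˡ-< b _ _ (begin-strict
      b * value D w         ≤⟨ above ⟩
      a * length A          ≡⟨ cong (a *_) ∣A∣≡ ⟩
      a * (b ∸ ∣ S ∣)       <⟨ legal⇔ a b S D≥0 .to legal i∈S ⟩
      b * value D i         ∎)
      where open ≤-Reasoning

    ≼w : ∀ {i} → i ∈ A → value D i ≤ value D w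
    ≼w = All.lookup (AllPairs-pivotˡ A (subst (Ascending D) L≡ (ordering-ascending D D≥0)))

    S⊆B : ∀ {i} → i Subset.∈ S → i ∈ B
    S⊆B {i} i∈S with ∈-++⁻ A (subst (i ∈_) L≡ (ordering-complete D i))
    ... | inj₁ i∈A         = ⊥-elim (<⇒≱ (w≺ i∈S) (≼w i∈A))
    ... | inj₂ (here refl) = ⊥-elim (<-irrefl refl (w≺ i∈S))
    ... | inj₂ (there i∈B) = i∈B

    ∣B∣<∣S∣ : length B < ∣ S ∣
    ∣B∣<∣S∣ = ≤-reflexive (+-cancelˡ-≡ (length A) _ _ (trans (length-split L≡)
                (trans (sym (m∸n+n≡m (Subset.∣p∣≤n S))) (cong (_+ ∣ S ∣) (sym ∣A∣≡)))))

  -- When ordering D ≡ A ++ w ∷ B, the north step labelled w starts at (D w , length A).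
  LastStepsOnOrAbove : ℕ → Set
  LastStepsOnOrAbove k = ∀ A w B → ordering D ≡ A ++ w ∷ B → b ∸ suc k ≤ length A →
                         OnOrAbove a b (value D w , length A)

  LPathCond⇔LastStepsOnOrAbove : ∀ k → LPathCond a b k D ⇔ LastStepsOnOrAbove k
  LPathCond⇔LastStepsOnOrAbove k = mk⇔
    (λ cond → drop-northStartsAt⁻ D (b ∸ suc k) 0 (ordering D) (subst (All _) lastN≡ cond))
    (λ steps → subst (All _) (sym lastN≡) (drop-northStartsAt⁺ D (b ∸ suc k) 0 (ordering D) steps))
    where
    lastN≡ = lastN-northStarts-lpath D a k D≥0

  KStable⇒LastStepsOnOrAbove : ∀ {k} → k < b → KStable a b k D → LastStepsOnOrAbove k
  KStable⇒LastStepsOnOrAbove {k} k<b stable A w B L≡ b∸1+k≤∣A∣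
    with b * value D w ≤? a * length A
  ... | yes above = above
  ... | no ¬above = ⊥-elim (stable S 0<∣S∣ ∣S∣≤1+k (below⇒legal L≡ (≰⇒> ¬above)))
    where
    open ≤-Reasoning
    S = fromList (w ∷ B)

    0<∣S∣ : 0 < ∣ S ∣
    0<∣S∣ = ≤-<-trans z≤n (Subset.x∈p⇒∣p-x∣<∣p∣ (∈-fromList⁺ {xs = w ∷ B} (here refl)))

    ∣S∣≤1+k : ∣ S ∣ ≤ suc k
    ∣S∣≤1+k = begin
      ∣ S ∣                                ≤⟨ ∣fromList∣≤length (w ∷ B) ⟩
      suc (length B)                       ≡⟨ m+n∸m≡n (length A) _ ⟨
      length A + suc (length B) ∸ length A ≡⟨ cong (_∸ length A) (length-split L≡) ⟩
      b ∸ length A                         ≤⟨ ∸-monoʳ-≤ b b∸1+k≤∣A∣ ⟩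
      b ∸ (b ∸ suc k)                      ≡⟨ m∸[m∸n]≡n k<b ⟩
      suc k                                ∎

  LastStepsOnOrAbove⇒KStable : ∀ {k} → LastStepsOnOrAbove k → KStable a b k D
  LastStepsOnOrAbove⇒KStable {k} steps S 0<∣S∣ ∣S∣≤1+k legal
    with split-at (b ∸ ∣ S ∣) (ordering D)
           (subst (b ∸ ∣ S ∣ <_) (sym (length-ordering D)) (∸-monoʳ-< 0<∣S∣ (Subset.∣p∣≤n S)))
  ... | A , w , B , L≡ , ∣A∣≡ = legal⇒below {S} legal 0<∣S∣ L≡ ∣A∣≡
          (steps A w B L≡ (subst (b ∸ suc k ≤_) (sym ∣A∣≡) (∸-monoʳ-≤ b ∣S∣≤1+k)))

lemma4p2 : (a b : ℕ) → .{{_ : NonZero a}} → .{{_ : NonZero b}} → Coprime a b →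
           (k : ℕ) → k < b → (D : Config b) → NonNeg D →
           (KStable a b k D ⇔ LPathCond a b k D)
lemma4p2 a b _ k k<b D D≥0 = mk⇔
  (λ stable → LPathCond⇔LastStepsOnOrAbove a b D≥0 k .from (KStable⇒LastStepsOnOrAbove a b D≥0 k<b stable))
  (λ cond → LastStepsOnOrAbove⇒KStable a b D≥0 (LPathCond⇔LastStepsOnOrAbove a b D≥0 k .to cond))
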